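{- Let $n,k$ be positive integers with $n \ge 2k$, and let $J_{n,k}$ be the Johnson graph. Two vertices $A,B \in V(J_{n,k})$ are mutually maximally distant if and only if $d(A,B)=k$.
   Context: The Johnson graph $J_{n,k}$ has as vertices all $k$-element subsets of $[n]=\{1,\dots,n\}$, two being adjacent iff their intersection has exactly $k-1$ elements; $d$ denotes the shortest-path distance. For a vertex $v$, $N(v)$ is its set of neighbours. Two vertices $u,v$ of a connected graph are mutually maximally distant if $d(v,w_1)\le d(u,v)$ for every $w_1\in N(u)$ and $d(u,w_2)\le d(u,v)$ for every $w_2\in N(v)$. -}

module Defs where

open import Data.Nat using (ℕ; zero; suc; _≤_; _∸_)
open import Data.Fin.Subset using (Subset; _∩_; ∣_∣)
open import Data.Product using (Σ; _×_; proj₁)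
open import Relation.Binary.PropositionalEquality using (_≡_)

Vertex : ℕ → ℕ → Set
Vertex n k = Σ (Subset n) (λ A → ∣ A ∣ ≡ k)

Adj : {n k : ℕ} → Vertex n k → Vertex n k → Set
Adj {n} {k} A B = ∣ proj₁ A ∩ proj₁ B ∣ ≡ k ∸ 1

data Walk {n k : ℕ} : Vertex n k → Vertex n k → ℕ → Set where
  here : (A : Vertex n k) → Walk A A zero
  step : {A B C : Vertex n k} {m : ℕ} → Adj A B → Walk B C m → Walk A C (suc m)

IsDist : {n k : ℕ} → Vertex n k → Vertex n k → ℕ → Set
IsDist A B m = Walk A B m × (∀ m' → Walk A B m' → m ≤ m')

MutMaxDist : {n k : ℕ} → Vertex n k → Vertex n k → Set
MutMaxDist A B =
  ∀ d → IsDist A B d →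
    (∀ W → Adj A W → ∀ e → IsDist B W e → e ≤ d) ×
    (∀ W → Adj B W → ∀ e → IsDist A W e → e ≤ d)

-- The distance in J(n,k) is d(A,B) = k − |A ∩ B|: along an edge |· ∩ B| changes by at
-- most one (submodularity of cardinality), and exchanging an element of A ∖ B for one of
-- B ∖ A raises it by one. So vertices at distance k, the diameter, are mutually maximally
-- distant. Conversely, if x ∈ A ∩ B then |A ∪ B| < 2k ≤ n gives some y ∉ A ∪ B, and the
-- neighbour A − x + y of A is strictly farther from B than A is.
module Submission where

open import Data.Bool.Base using (_∧_)
open import Data.Bool.Properties using (¬-not)
open import Data.Fin.Base using (Fin; zero; suc)
open import Data.Fin.Subset
open import Data.Fin.Subset.Properties
open import Data.Nat.Base using (ℕ; zero; suc; _+_; _*_; _∸_; _<_; _≤_; z≤n; s≤s)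
open import Data.Nat.Properties
open import Algebra.Properties.CommutativeSemigroup +-commutativeSemigroup using (x∙yz≈y∙xz)
open import Data.Product.Base using (_×_; _,_; proj₁; proj₂; ∃)
open import Data.Sum.Base using ([_,_]; inj₁; inj₂)
open import Data.Vec.Base using ([]; _∷_; lookup; _[_]≔_; here)
open import Data.Vec.Properties using ([]=⇒lookup; lookup⇒[]=; lookup∘updateAt′)
open import Function.Base using (_∘_)
open import Function.Bundles using (_⇔_; mk⇔)
open import Relation.Binary.PropositionalEquality
  using (_≡_; _≢_; refl; sym; trans; cong; cong₂; subst; subst₂; module ≡-Reasoning)
open import Relation.Nullary using (¬_; yes; no; contradiction)

open import Defs

private variable
  n : ℕ
  p q : Subset n
  x : Fin n

χ : Side → ℕ
χ inside  = 1
χ outside = 0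

χ-∈ : x ∈ p → χ (lookup p x) ≡ 1
χ-∈ x∈p = cong χ ([]=⇒lookup x∈p)

x∉p⇒lookup≡outside : x ∉ p → lookup p x ≡ outside
x∉p⇒lookup≡outside {x = x} {p = p} x∉p = ¬-not (x∉p ∘ lookup⇒[]= x p)

χ-∉ : x ∉ p → χ (lookup p x) ≡ 0
χ-∉ x∉p = cong χ (x∉p⇒lookup≡outside x∉p)

∣s∷p∣≡χs+∣p∣ : ∀ s (p : Subset n) → ∣ s ∷ p ∣ ≡ χ s + ∣ p ∣
∣s∷p∣≡χs+∣p∣ inside  p = refl
∣s∷p∣≡χs+∣p∣ outside p = refl

∣p∪q∣+∣p∩q∣≡∣p∣+∣q∣ : ∀ (p q : Subset n) → ∣ p ∪ q ∣ + ∣ p ∩ q ∣ ≡ ∣ p ∣ + ∣ q ∣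
∣p∪q∣+∣p∩q∣≡∣p∣+∣q∣ []            []            = refl
∣p∪q∣+∣p∩q∣≡∣p∣+∣q∣ (inside  ∷ p) (inside  ∷ q) = cong suc (begin
  ∣ p ∪ q ∣ + suc ∣ p ∩ q ∣ ≡⟨ +-suc _ _ ⟩
  suc (∣ p ∪ q ∣ + ∣ p ∩ q ∣) ≡⟨ cong suc (∣p∪q∣+∣p∩q∣≡∣p∣+∣q∣ p q) ⟩
  suc (∣ p ∣ + ∣ q ∣) ≡⟨ +-suc _ _ ⟨
  ∣ p ∣ + suc ∣ q ∣ ∎)
  where open ≡-Reasoning
∣p∪q∣+∣p∩q∣≡∣p∣+∣q∣ (inside  ∷ p) (outside ∷ q) = cong suc (∣p∪q∣+∣p∩q∣≡∣p∣+∣q∣ p q)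
∣p∪q∣+∣p∩q∣≡∣p∣+∣q∣ (outside ∷ p) (inside  ∷ q) =
  trans (cong suc (∣p∪q∣+∣p∩q∣≡∣p∣+∣q∣ p q)) (sym (+-suc _ _))
∣p∪q∣+∣p∩q∣≡∣p∣+∣q∣ (outside ∷ p) (outside ∷ q) = ∣p∪q∣+∣p∩q∣≡∣p∣+∣q∣ p q

∣q∩r∣+∣p∩q∣≤∣p∩r∣+∣q∣ : ∀ (p q r : Subset n) → ∣ q ∩ r ∣ + ∣ p ∩ q ∣ ≤ ∣ p ∩ r ∣ + ∣ q ∣
∣q∩r∣+∣p∩q∣≤∣p∩r∣+∣q∣ p q r = begin
  ∣ q ∩ r ∣ + ∣ p ∩ q ∣                     ≡⟨ ∣p∪q∣+∣p∩q∣≡∣p∣+∣q∣ (q ∩ r) (p ∩ q) ⟨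
  ∣ q ∩ r ∪ p ∩ q ∣ + ∣ (q ∩ r) ∩ (p ∩ q) ∣ ≤⟨ +-mono-≤ (p⊆q⇒∣p∣≤∣q∣ ∪⊆q) (p⊆q⇒∣p∣≤∣q∣ ∩⊆p∩r) ⟩
  ∣ q ∣ + ∣ p ∩ r ∣                         ≡⟨ +-comm ∣ q ∣ ∣ p ∩ r ∣ ⟩
  ∣ p ∩ r ∣ + ∣ q ∣                         ∎
  where
  open ≤-Reasoning
  ∪⊆q : q ∩ r ∪ p ∩ q ⊆ q
  ∪⊆q x∈ = [ proj₁ ∘ x∈p∩q⁻ q r , proj₂ ∘ x∈p∩q⁻ p q ] (x∈p∪q⁻ (q ∩ r) (p ∩ q) x∈)
  ∩⊆p∩r : (q ∩ r) ∩ (p ∩ q) ⊆ p ∩ r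
  ∩⊆p∩r x∈ with x∈p∩q⁻ (q ∩ r) (p ∩ q) x∈
  ... | x∈q∩r , x∈p∩q = x∈p∩q⁺ (proj₁ (x∈p∩q⁻ p q x∈p∩q) , proj₂ (x∈p∩q⁻ q r x∈q∩r))

p⊆q⇒∣p∣≡∣q∣⇒p≡q : p ⊆ q → ∣ p ∣ ≡ ∣ q ∣ → p ≡ q
p⊆q⇒∣p∣≡∣q∣⇒p≡q {p = []}          {[]}          _   _  = refl
p⊆q⇒∣p∣≡∣q∣⇒p≡q {p = outside ∷ p} {outside ∷ q} p⊆q eq =
  cong (outside ∷_) (p⊆q⇒∣p∣≡∣q∣⇒p≡q (drop-∷-⊆ p⊆q) eq)
p⊆q⇒∣p∣≡∣q∣⇒p≡q {p = outside ∷ p} {inside  ∷ q} p⊆q eq =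
  contradiction (p⊆q⇒∣p∣≤∣q∣ (drop-∷-⊆ p⊆q)) (<⇒≱ (≤-reflexive (sym eq)))
p⊆q⇒∣p∣≡∣q∣⇒p≡q {p = inside  ∷ p} {outside ∷ q} p⊆q eq = contradiction (p⊆q here) λ ()
p⊆q⇒∣p∣≡∣q∣⇒p≡q {p = inside  ∷ p} {inside  ∷ q} p⊆q eq =
  cong (inside ∷_) (p⊆q⇒∣p∣≡∣q∣⇒p≡q (drop-∷-⊆ p⊆q) (suc-injective eq))

0<∣p∣⇒Nonempty : 0 < ∣ p ∣ → Nonempty p
0<∣p∣⇒Nonempty {n} {p} 0<∣p∣ with nonempty? p
... | yes ne = ne
... | no ¬ne = contradiction (trans (cong ∣_∣ (Empty-unique ¬ne)) (∣⊥∣≡0 n)) (>⇒≢ 0<∣p∣)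

∣p∩q∣<∣p∣⇒∃x∈p∖q : ∣ p ∩ q ∣ < ∣ p ∣ → ∃ λ x → x ∈ p × x ∉ q
∣p∩q∣<∣p∣⇒∃x∈p∖q {p = p} {q} ∣p∩q∣<∣p∣ with nonempty? (p ∩ ∁ q)
... | yes (x , x∈p∩∁q) = x , proj₁ (x∈p∩q⁻ p (∁ q) x∈p∩∁q) , x∈∁p⇒x∉p (proj₂ (x∈p∩q⁻ p (∁ q) x∈p∩∁q))
... | no p∩∁q-empty = contradiction (p⊆q⇒∣p∣≤∣q∣ p⊆p∩q) (<⇒≱ ∣p∩q∣<∣p∣)
  where
  p⊆p∩q : p ⊆ p ∩ q
  p⊆p∩q {x} x∈p with x ∈? q
  ... | yes x∈q = x∈p∩q⁺ (x∈p , x∈q)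
  ... | no  x∉q = contradiction (x , x∈p∩q⁺ (x∈p , x∉p⇒x∈∁p x∉q)) p∩∁q-empty

∣p∪q∣<n⇒∃x∉p∪q : ∀ (p q : Subset n) → ∣ p ∪ q ∣ < n → ∃ λ x → x ∉ p × x ∉ q
∣p∪q∣<n⇒∃x∉p∪q {n} p q ∣p∪q∣<n
  with ∣p∩q∣<∣p∣⇒∃x∈p∖q {p = ⊤} {q = p ∪ q}
         (subst₂ _<_ (sym (cong ∣_∣ (∩-identityˡ (p ∪ q)))) (sym (∣⊤∣≡n n)) ∣p∪q∣<n)
... | x , _ , x∉p∪q = x , x∉p∪q ∘ x∈p∪q⁺ ∘ inj₁ , x∉p∪q ∘ x∈p∪q⁺ ∘ inj₂

∣p[x]≔t∩q∣ : ∀ (p q : Subset n) x t {s} → lookup p x ≡ s →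
  χ (s ∧ lookup q x) + ∣ (p [ x ]≔ t) ∩ q ∣ ≡ χ (t ∧ lookup q x) + ∣ p ∩ q ∣
∣p[x]≔t∩q∣ (a ∷ p) (c ∷ q) zero t refl = begin
  χ (a ∧ c) + ∣ (t ∧ c) ∷ p ∩ q ∣         ≡⟨ cong (χ (a ∧ c) +_) (∣s∷p∣≡χs+∣p∣ (t ∧ c) (p ∩ q)) ⟩
  χ (a ∧ c) + (χ (t ∧ c) + ∣ p ∩ q ∣)     ≡⟨ x∙yz≈y∙xz (χ (a ∧ c)) (χ (t ∧ c)) ∣ p ∩ q ∣ ⟩
  χ (t ∧ c) + (χ (a ∧ c) + ∣ p ∩ q ∣)     ≡⟨ cong (χ (t ∧ c) +_) (∣s∷p∣≡χs+∣p∣ (a ∧ c) (p ∩ q)) ⟨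
  χ (t ∧ c) + ∣ (a ∧ c) ∷ p ∩ q ∣         ∎
  where open ≡-Reasoning
∣p[x]≔t∩q∣ (a ∷ p) (c ∷ q) (suc x) t refl = begin
  χ (s ∧ qx) + ∣ (a ∧ c) ∷ (p [ x ]≔ t) ∩ q ∣           ≡⟨ cong (χ (s ∧ qx) +_) (∣s∷p∣≡χs+∣p∣ (a ∧ c) ((p [ x ]≔ t) ∩ q)) ⟩
  χ (s ∧ qx) + (χ (a ∧ c) + ∣ (p [ x ]≔ t) ∩ q ∣)       ≡⟨ x∙yz≈y∙xz (χ (s ∧ qx)) (χ (a ∧ c)) _ ⟩
  χ (a ∧ c) + (χ (s ∧ qx) + ∣ (p [ x ]≔ t) ∩ q ∣)       ≡⟨ cong (χ (a ∧ c) +_) (∣p[x]≔t∩q∣ p q x t refl) ⟩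
  χ (a ∧ c) + (χ (t ∧ qx) + ∣ p ∩ q ∣)                  ≡⟨ x∙yz≈y∙xz (χ (a ∧ c)) (χ (t ∧ qx)) _ ⟩
  χ (t ∧ qx) + (χ (a ∧ c) + ∣ p ∩ q ∣)                  ≡⟨ cong (χ (t ∧ qx) +_) (∣s∷p∣≡χs+∣p∣ (a ∧ c) (p ∩ q)) ⟨
  χ (t ∧ qx) + ∣ (a ∧ c) ∷ p ∩ q ∣                      ∎
  where
  open ≡-Reasoning
  s = lookup p x
  qx = lookup q x

swap : Subset n → Fin n → Fin n → Subset n
swap p x y = p [ x ]≔ outside [ y ]≔ inside

∣swap∩q∣ : ∀ {p : Subset n} {x y} → x ∈ p → y ∉ p → ∀ q →
  χ (lookup q x) + ∣ swap p x y ∩ q ∣ ≡ χ (lookup q y) + ∣ p ∩ q ∣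
∣swap∩q∣ {p = p} {x} {y} x∈p y∉p q = begin
  χ (lookup q x) + ∣ swap p x y ∩ q ∣                   ≡⟨ cong (χ (lookup q x) +_) insert-y ⟩
  χ (lookup q x) + (χ (lookup q y) + ∣ p′ ∩ q ∣)       ≡⟨ x∙yz≈y∙xz (χ (lookup q x)) (χ (lookup q y)) _ ⟩
  χ (lookup q y) + (χ (lookup q x) + ∣ p′ ∩ q ∣)       ≡⟨ cong (χ (lookup q y) +_) remove-x ⟩
  χ (lookup q y) + ∣ p ∩ q ∣                            ∎
  where
  open ≡-Reasoning
  p′ = p [ x ]≔ outside
  y≢x : y ≢ x
  y≢x refl = y∉p x∈p
  insert-y : ∣ swap p x y ∩ q ∣ ≡ χ (lookup q y) + ∣ p′ ∩ q ∣
  insert-y = ∣p[x]≔t∩q∣ p′ q y inside (trans (lookup∘updateAt′ y x y≢x p) (x∉p⇒lookup≡outside y∉p))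
  remove-x : χ (lookup q x) + ∣ p′ ∩ q ∣ ≡ ∣ p ∩ q ∣
  remove-x = ∣p[x]≔t∩q∣ p q x outside ([]=⇒lookup x∈p)

∣swap∣≡∣p∣ : ∀ {p : Subset n} {x y} → x ∈ p → y ∉ p → ∣ swap p x y ∣ ≡ ∣ p ∣
∣swap∣≡∣p∣ {p = p} {x} {y} x∈p y∉p = begin
  ∣ swap p x y ∣      ≡⟨ cong ∣_∣ (∩-identityʳ (swap p x y)) ⟨
  ∣ swap p x y ∩ ⊤ ∣  ≡⟨ suc-injective (subst₂ (λ a b → a + ∣ swap p x y ∩ ⊤ ∣ ≡ b + ∣ p ∩ ⊤ ∣)
                          (χ-∈ {x = x} {p = ⊤} ∈⊤) (χ-∈ {x = y} {p = ⊤} ∈⊤) (∣swap∩q∣ x∈p y∉p ⊤)) ⟩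
  ∣ p ∩ ⊤ ∣           ≡⟨ cong ∣_∣ (∩-identityʳ p) ⟩
  ∣ p ∣               ∎
  where open ≡-Reasoning

∣swap∩q∣≡1+∣p∩q∣ : ∀ {p q : Subset n} {x y} → x ∈ p → y ∉ p → x ∉ q → y ∈ q →
  ∣ swap p x y ∩ q ∣ ≡ suc ∣ p ∩ q ∣
∣swap∩q∣≡1+∣p∩q∣ {p = p} {q} {x} {y} x∈p y∉p x∉q y∈q =
  subst₂ (λ a b → a + ∣ swap p x y ∩ q ∣ ≡ b + ∣ p ∩ q ∣) (χ-∉ x∉q) (χ-∈ y∈q) (∣swap∩q∣ x∈p y∉p q)

1+∣swap∩q∣≡∣p∩q∣ : ∀ {p q : Subset n} {x y} → x ∈ p → y ∉ p → x ∈ q → y ∉ q →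
  suc ∣ swap p x y ∩ q ∣ ≡ ∣ p ∩ q ∣
1+∣swap∩q∣≡∣p∩q∣ {p = p} {q} {x} {y} x∈p y∉p x∈q y∉q =
  subst₂ (λ a b → a + ∣ swap p x y ∩ q ∣ ≡ b + ∣ p ∩ q ∣) (χ-∈ x∈q) (χ-∉ y∉q) (∣swap∩q∣ x∈p y∉p q)

module _ {n k : ℕ} where

  common : Vertex n k → Vertex n k → ℕ
  common A B = ∣ proj₁ A ∩ proj₁ B ∣

  common-comm : ∀ A B → common A B ≡ common B A
  common-comm A B = cong ∣_∣ (∩-comm (proj₁ A) (proj₁ B))

  common-≤ : ∀ A B → common A B ≤ k
  common-≤ A B = subst (common A B ≤_) (proj₂ A) (∣p∩q∣≤∣p∣ (proj₁ A) (proj₁ B))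

  common-self : ∀ A → common A A ≡ k
  common-self A = trans (cong ∣_∣ (∩-idem (proj₁ A))) (proj₂ A)

  common≡k⇒≡ : ∀ A B → common A B ≡ k → A ≡ B
  common≡k⇒≡ (a , ∣a∣≡k) (b , ∣b∣≡k) a∩b≡k with trans (sym a∩b=a) a∩b=b
    where
    a∩b=a : a ∩ b ≡ a
    a∩b=a = p⊆q⇒∣p∣≡∣q∣⇒p≡q (p∩q⊆p a b) (trans a∩b≡k (sym ∣a∣≡k))
    a∩b=b : a ∩ b ≡ b
    a∩b=b = p⊆q⇒∣p∣≡∣q∣⇒p≡q (p∩q⊆q a b) (trans a∩b≡k (sym ∣b∣≡k))
  ... | refl = cong (a ,_) (≡-irrelevant ∣a∣≡k ∣b∣≡k)

  Adj⇒common-≤ : 1 ≤ k → ∀ {X Z} → Adj X Z → ∀ Y → common Z Y ≤ suc (common X Y)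
  Adj⇒common-≤ 1≤k {X} {Z} X~Z Y = +-cancelʳ-≤ (common X Z) _ _ (begin
    common Z Y + common X Z           ≤⟨ ∣q∩r∣+∣p∩q∣≤∣p∩r∣+∣q∣ (proj₁ X) (proj₁ Z) (proj₁ Y) ⟩
    common X Y + ∣ proj₁ Z ∣          ≡⟨ cong (common X Y +_) ∣Z∣≡1+∣X∩Z∣ ⟩
    common X Y + suc (common X Z)     ≡⟨ +-suc (common X Y) (common X Z) ⟩
    suc (common X Y) + common X Z     ∎)
    where
    open ≤-Reasoning
    ∣Z∣≡1+∣X∩Z∣ : ∣ proj₁ Z ∣ ≡ suc (common X Z)
    ∣Z∣≡1+∣X∩Z∣ = trans (proj₂ Z) (trans (sym (m+[n∸m]≡n 1≤k)) (cong suc (sym X~Z)))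

  Walk⇒k≤common+length : 1 ≤ k → ∀ {X Y m} → Walk X Y m → k ≤ common X Y + m
  Walk⇒k≤common+length 1≤k (here X) = ≤-reflexive (trans (sym (common-self X)) (sym (+-identityʳ _)))
  Walk⇒k≤common+length 1≤k {X} {Y} (step {B = Z} {m = m} X~Z Z⇝Y) = begin
    k                        ≤⟨ Walk⇒k≤common+length 1≤k Z⇝Y ⟩
    common Z Y + m           ≤⟨ +-monoˡ-≤ m (Adj⇒common-≤ 1≤k {X} {Z} X~Z Y) ⟩
    suc (common X Y) + m     ≡⟨ +-suc (common X Y) m ⟨
    common X Y + suc m       ∎
    where open ≤-Reasoning

  exchange : ∀ (X : Vertex n k) {x y} → x ∈ proj₁ X → y ∉ proj₁ X → Vertex n k
  exchange (p , ∣p∣≡k) {x} {y} x∈p y∉p = swap p x y , trans (∣swap∣≡∣p∣ x∈p y∉p) ∣p∣≡k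

  exchange-adjacent : ∀ X {x y} (x∈X : x ∈ proj₁ X) (y∉X : y ∉ proj₁ X) → Adj X (exchange X x∈X y∉X)
  exchange-adjacent X {x} {y} x∈X y∉X = begin
    ∣ proj₁ X ∩ swap (proj₁ X) x y ∣        ≡⟨ cong ∣_∣ (∩-comm (proj₁ X) _) ⟩
    ∣ swap (proj₁ X) x y ∩ proj₁ X ∣        ≡⟨ m+n∸m≡n 1 _ ⟨
    suc ∣ swap (proj₁ X) x y ∩ proj₁ X ∣ ∸ 1 ≡⟨ cong (_∸ 1) (1+∣swap∩q∣≡∣p∩q∣ x∈X y∉X x∈X y∉X) ⟩
    common X X ∸ 1                          ≡⟨ cong (_∸ 1) (common-self X) ⟩
    k ∸ 1                                   ∎
    where open ≡-Reasoning

  common+length≡k⇒Walk : ∀ m X Y → common X Y + m ≡ k → Walk X Y m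
  common+length≡k⇒Walk zero X Y ∣X∩Y∣+0≡k =
    subst (λ Z → Walk X Z 0) (common≡k⇒≡ X Y (trans (sym (+-identityʳ _)) ∣X∩Y∣+0≡k)) (here X)
  common+length≡k⇒Walk (suc m) X Y ∣X∩Y∣+1+m≡k
    with ∣p∩q∣<∣p∣⇒∃x∈p∖q (subst (common X Y <_) (sym (proj₂ X)) common<k)
       | ∣p∩q∣<∣p∣⇒∃x∈p∖q (subst₂ _<_ (common-comm X Y) (sym (proj₂ Y)) common<k)
    where
    common<k : common X Y < k
    common<k = subst (common X Y <_) ∣X∩Y∣+1+m≡k (m<m+n (common X Y) (s≤s z≤n))
  ... | x , x∈X , x∉Y | y , y∈Y , y∉X =
    step (exchange-adjacent X x∈X y∉X) (common+length≡k⇒Walk m W Y ∣W∩Y∣+m≡k)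
    where
    W = exchange X x∈X y∉X
    ∣W∩Y∣+m≡k : common W Y + m ≡ k
    ∣W∩Y∣+m≡k = trans (cong (_+ m) (∣swap∩q∣≡1+∣p∩q∣ x∈X y∉X x∉Y y∈Y))
                      (trans (sym (+-suc (common X Y) m)) ∣X∩Y∣+1+m≡k)

  IsDist-common : 1 ≤ k → ∀ X Y → IsDist X Y (k ∸ common X Y)
  IsDist-common 1≤k X Y =
    common+length≡k⇒Walk _ X Y (m+[n∸m]≡n (common-≤ X Y)) ,
    λ m X⇝Y → m≤n+o⇒m∸n≤o k (common X Y) (Walk⇒k≤common+length 1≤k X⇝Y)

  IsDist-unique : ∀ {X Y : Vertex n k} {d e} → IsDist X Y d → IsDist X Y e → d ≡ e
  IsDist-unique (X⇝Y , d-min) (X⇝Y′ , e-min) = ≤-antisym (d-min _ X⇝Y′) (e-min _ X⇝Y)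

  IsDist⇒≤k : 1 ≤ k → ∀ {X Y d} → IsDist X Y d → d ≤ k
  IsDist⇒≤k 1≤k {X} {Y} (_ , d-min) =
    ≤-trans (d-min _ (proj₁ (IsDist-common 1≤k X Y))) (m∸n≤m k (common X Y))

  farther-neighbour : 2 * k ≤ n → ∀ A B → 0 < common A B →
    ∃ λ W → Adj A W × suc (common B W) ≡ common A B
  farther-neighbour 2k≤n A B 0<∣A∩B∣
    with 0<∣p∣⇒Nonempty 0<∣A∩B∣ | ∣p∪q∣<n⇒∃x∉p∪q (proj₁ A) (proj₁ B) ∣A∪B∣<n
    where
    open ≤-Reasoning
    ∣A∪B∣<n : ∣ proj₁ A ∪ proj₁ B ∣ < n
    ∣A∪B∣<n = begin-strict
      ∣ proj₁ A ∪ proj₁ B ∣               <⟨ m<m+n _ 0<∣A∩B∣ ⟩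
      ∣ proj₁ A ∪ proj₁ B ∣ + common A B  ≡⟨ ∣p∪q∣+∣p∩q∣≡∣p∣+∣q∣ (proj₁ A) (proj₁ B) ⟩
      ∣ proj₁ A ∣ + ∣ proj₁ B ∣           ≡⟨ cong₂ _+_ (proj₂ A) (proj₂ B) ⟩
      k + k                               ≡⟨ cong (k +_) (+-identityʳ k) ⟨
      2 * k                               ≤⟨ 2k≤n ⟩
      n                                   ∎
  ... | x , x∈A∩B | y , y∉A , y∉B =
    W , exchange-adjacent A x∈A y∉A ,
    trans (cong suc (common-comm B W)) (1+∣swap∩q∣≡∣p∩q∣ x∈A y∉A x∈B y∉B)
    where
    x∈A = proj₁ (x∈p∩q⁻ (proj₁ A) (proj₁ B) x∈A∩B)
    x∈B = proj₂ (x∈p∩q⁻ (proj₁ A) (proj₁ B) x∈A∩B)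
    W = exchange A x∈A y∉A

  MutMaxDist⇒common≡0 : 1 ≤ k → 2 * k ≤ n → ∀ A B → MutMaxDist A B → common A B ≡ 0
  MutMaxDist⇒common≡0 1≤k 2k≤n A B mmd = n≤0⇒n≡0 (≮⇒≥ no-common)
    where
    no-common : ¬ (0 < common A B)
    no-common 0<∣A∩B∣ with farther-neighbour 2k≤n A B 0<∣A∩B∣
    ... | W , A~W , 1+∣B∩W∣≡∣A∩B∣ =
      <⇒≱ (∸-monoʳ-< (≤-reflexive 1+∣B∩W∣≡∣A∩B∣) (common-≤ A B))
          (proj₁ (mmd _ (IsDist-common 1≤k A B)) W A~W _ (IsDist-common 1≤k B W))

lemma2 : (n k : ℕ) → 1 ≤ k → 2 * k ≤ n → (A B : Vertex n k) →
    MutMaxDist A B ⇔ IsDist A B k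
lemma2 n k 1≤k 2k≤n A B = mk⇔ to from
  where
  to : MutMaxDist A B → IsDist A B k
  to mmd = subst (λ c → IsDist A B (k ∸ c)) (MutMaxDist⇒common≡0 1≤k 2k≤n A B mmd)
                 (IsDist-common 1≤k A B)
  from : IsDist A B k → MutMaxDist A B
  from dist≡k d dist≡d = (λ _ _ → bounded) , (λ _ _ → bounded)
    where
    bounded : ∀ {X W : Vertex n k} e → IsDist X W e → e ≤ d
    bounded e dist≡e = subst (e ≤_) (IsDist-unique dist≡k dist≡d) (IsDist⇒≤k 1≤k dist≡e)
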